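{- Let $\Gamma$ be a finite group and $\Delta=(\delta_1,\dots,\delta_d)$ a finite list of elements of $\Gamma$ generating $\Gamma$, and let $G$ be the directed Cayley graph with vertex set $\Gamma$ and, for each $g\in\Gamma$ and each entry $\delta$ of $\Delta$, a directed edge $(g,g\delta)$ labeled by that entry. For each $g\in\Gamma$, $g\neq e$, choose a word $w(g)=\delta(1)\delta(2)\cdots\delta(m)$ in the entries of $\Delta$ whose product equals $g$; it determines the directed path $e,\ \delta(1),\ \delta(1)\delta(2),\dots, g$ from $e$ to $g$. Suppose each occurrence of a letter in each word $w(g)$ is assigned a positive integer time such that times strictly increase along each word, and no entry of $\Delta$ is assigned the same time at two different occurrences (in the same or different words). For $h\in\Gamma$, let $hw(g)$ denote the directed path $h,\ h\delta(1),\ h\delta(1)\delta(2),\dots,hg$ from $h$ to $hg$, whose edges receive the same times as the corresponding letters of $w(g)$. Then the collection of paths $hw(g)$, $h\in\Gamma$, $g\in\Gamma\setminus\{e\}$, is a communication graph for transpose on $G$; that is, it contains a time-increasing path from every vertex to every other vertex and no edge of $G$ receives the same time twice.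
   Context: A communication graph (schedule) for transpose on a directed graph $G$ is a choice, for every ordered pair $(u,w)$ of distinct vertices, of a directed path from $u$ to $w$ with edges labeled by positive integer times strictly increasing along the path, such that no edge of $G$ receives the same time twice over all the paths. Edges arising from different entries of $\Delta$ are considered distinct edges even if the entries coincide as group elements. -}

module Defs where

open import Data.Nat using (ℕ; _≤_; _<_)
open import Data.Fin as F using (Fin; toℕ)
open import Data.List using (List; []; _∷_; length; lookup; take; map)
open import Data.Product using (Σ; _×_; _,_; proj₁; proj₂)
open import Relation.Binary.PropositionalEquality using (_≡_)
open import Relation.Nullary using (¬_)
open import Algebra.Structures using (IsGroup)
open import Function.Bundles using (_↔_)

record FiniteGroup : Set₁ where
  infixl 7 _∙_
  field
    Carrier : Set
    _∙_     : Carrier → Carrier → Carrier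
    e       : Carrier
    _⁻¹     : Carrier → Carrier
    isGroup : IsGroup _≡_ _∙_ e _⁻¹
    size    : ℕ
    enum    : Fin size ↔ Carrier

-- Edges are pairs (g , i) : Γ × Fin d, going from g to g ∙ Δ i; edges with
-- different indices i are distinct even when Δ i coincide as group elements.
module Cayley (Γ : FiniteGroup) {d : ℕ} (Δ : Fin d → FiniteGroup.Carrier Γ) where
  open FiniteGroup Γ

  data InSubgroup : Carrier → Set where
    gen  : (i : Fin d) → InSubgroup (Δ i)
    unit : InSubgroup e
    mul  : ∀ {x y} → InSubgroup x → InSubgroup y → InSubgroup (x ∙ y)
    inv  : ∀ {x} → InSubgroup x → InSubgroup (x ⁻¹)

  Generates : Set
  Generates = ∀ g → InSubgroup g

  Word : Set
  Word = List (Fin d)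

  prod : Word → Carrier
  prod []      = e
  prod (i ∷ w) = Δ i ∙ prod w

  -- a timed walk: the sequence of edge labels together with the time of each edge;
  -- starting at vertex u, the k-th edge goes from u ∙ prod(first k labels)
  -- with label (index) lookup k.
  TimedPath : Set
  TimedPath = List (Fin d × ℕ)

  labels : TimedPath → Word
  labels p = map proj₁ p

  endpoint : Carrier → TimedPath → Carrier
  endpoint u p = u ∙ prod (labels p)

  source : Carrier → (p : TimedPath) → Fin (length p) → Carrier
  source u p k = u ∙ prod (take (toℕ k) (labels p))

  label : (p : TimedPath) → Fin (length p) → Fin d
  label p k = proj₁ (lookup p k)

  time : (p : TimedPath) → Fin (length p) → ℕ
  time p k = proj₂ (lookup p k)

  TimeIncreasing : TimedPath → Set
  TimeIncreasing p =
    (∀ k → 1 ≤ time p k) × (∀ k k' → k F.< k' → time p k < time p k')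

  -- A schedule assigns to every ordered pair (u , v) a timed path (only pairs with
  -- u ≢ v matter).  It is a communication graph for transpose if each S u v
  -- (u ≢ v) is a time-increasing directed path from u to v, and no edge of G
  -- receives the same time twice over all these paths.
  IsCommGraph : (Carrier → Carrier → TimedPath) → Set
  IsCommGraph S =
    (∀ u v → ¬ u ≡ v → endpoint u (S u v) ≡ v × TimeIncreasing (S u v)) ×
    (∀ u v u' v' → ¬ u ≡ v → ¬ u' ≡ v' →
       (k : Fin (length (S u v))) (k' : Fin (length (S u' v'))) →
       source u (S u v) k ≡ source u' (S u' v') k' →
       label (S u v) k ≡ label (S u' v') k' →
       time (S u v) k ≡ time (S u' v') k' →
       _≡_ {A = Σ (Carrier × Carrier) (λ uv → Fin (length (S (proj₁ uv) (proj₂ uv))))}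
           ((u , v) , k) ((u' , v') , k'))

  timed : (w : Word) → (Fin (length w) → ℕ) → TimedPath
  timed []      τ = []
  timed (i ∷ w) τ = (i , τ F.zero) ∷ timed w (λ k → τ (F.suc k))

  -- the path h·w(g) from h to h g, indexed by its endpoints (h , h g), so g = h⁻¹ v
  translatedSchedule : (w : Carrier → Word) →
                       (τ : (g : Carrier) → Fin (length (w g)) → ℕ) →
                       Carrier → Carrier → TimedPath
  translatedSchedule w τ h v = timed (w (h ⁻¹ ∙ v)) (τ (h ⁻¹ ∙ v))

-- Left multiplication by h is an automorphism of the Cayley graph that maps the edge
-- (x , i) to (h x , i) and keeps times, so each path h·w(g) is a time-increasing path
-- from h to h g.  If two edges of the schedule coincide in label and time, they come
-- from the same occurrence of a letter in the same word w(g); since the edge also has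
-- the same source h·δ(1)⋯δ(k), cancelling the common prefix δ(1)⋯δ(k) on the right
-- gives the same h, hence the same path.
module Submission where

open import Defs
open import Data.Nat using (ℕ; suc; _≤_; _<_)
open import Data.Fin as F using (Fin; toℕ)
open import Data.Fin.Properties using (toℕ-cast; toℕ-injective)
open import Data.List using (List; []; _∷_; length; lookup; take)
open import Data.Product using (Σ; _×_; _,_; proj₁; proj₂)
open import Relation.Binary.PropositionalEquality
  using (_≡_; refl; sym; trans; cong; cong₂; subst; subst₂; module ≡-Reasoning)
open import Relation.Nullary using (¬_)
open import Algebra.Bundles using (Group)
import Algebra.Properties.Group as GroupProperties

Σ-Fin-≡⁺ : ∀ {A : Set} {n : A → ℕ} {a a' : A} {i : Fin (n a)} {i' : Fin (n a')} →
  a ≡ a' → toℕ i ≡ toℕ i' → _≡_ {A = Σ A (λ x → Fin (n x))} (a , i) (a' , i')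
Σ-Fin-≡⁺ refl i≡i' = cong (_ ,_) (toℕ-injective i≡i')

Σ-Fin-≡⁻ : ∀ {A : Set} {n : A → ℕ} {a a' : A} {i : Fin (n a)} {i' : Fin (n a')} →
  _≡_ {A = Σ A (λ x → Fin (n x))} (a , i) (a' , i') → a ≡ a' × toℕ i ≡ toℕ i'
Σ-Fin-≡⁻ refl = refl , refl

module FiniteGroupProperties (Γ : FiniteGroup) where
  open FiniteGroup Γ
  open import Algebra.Structures {A = Carrier} _≡_ using (module IsGroup)
  open IsGroup isGroup using (identityʳ)
  open IsGroup isGroup public using (_\\_)

  group : Group _ _
  group = record { Carrier = Carrier ; _≈_ = _≡_ ; _∙_ = _∙_ ; ε = e ; _⁻¹ = _⁻¹
                 ; isGroup = isGroup }

  open GroupProperties group using (\\-leftDividesˡ; ∙-cancelʳ) public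

  \\-≢-ε : ∀ {u v} → ¬ u ≡ v → ¬ u \\ v ≡ e
  \\-≢-ε {u} {v} u≢v u\\v≡e = u≢v (begin
    u            ≡⟨ identityʳ u ⟨
    u ∙ e        ≡⟨ cong (u ∙_) u\\v≡e ⟨
    u ∙ (u \\ v) ≡⟨ \\-leftDividesˡ u v ⟩
    v            ∎)
    where open ≡-Reasoning

module TimedWords (Γ : FiniteGroup) {d : ℕ} (Δ : Fin d → FiniteGroup.Carrier Γ) where
  open FiniteGroup Γ
  open Cayley Γ Δ

  length-timed : (w : Word) (τ : Fin (length w) → ℕ) → length (timed w τ) ≡ length w
  length-timed []      τ = refl
  length-timed (i ∷ w) τ = cong suc (length-timed w (λ k → τ (F.suc k)))

  letterIndex : (w : Word) (τ : Fin (length w) → ℕ) → Fin (length (timed w τ)) → Fin (length w)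
  letterIndex w τ = F.cast (length-timed w τ)

  toℕ-letterIndex : (w : Word) (τ : Fin (length w) → ℕ) (k : Fin (length (timed w τ))) →
    toℕ (letterIndex w τ k) ≡ toℕ k
  toℕ-letterIndex w τ = toℕ-cast (length-timed w τ)

  labels-timed : (w : Word) (τ : Fin (length w) → ℕ) → labels (timed w τ) ≡ w
  labels-timed []      τ = refl
  labels-timed (i ∷ w) τ = cong (i ∷_) (labels-timed w (λ k → τ (F.suc k)))

  lookup-timed : (w : Word) (τ : Fin (length w) → ℕ) (k : Fin (length (timed w τ))) →
    lookup (timed w τ) k ≡ (lookup w (letterIndex w τ k) , τ (letterIndex w τ k))
  lookup-timed (i ∷ w) τ F.zero    = refl
  lookup-timed (i ∷ w) τ (F.suc k) = lookup-timed w (λ k → τ (F.suc k)) k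

  label-timed : (w : Word) (τ : Fin (length w) → ℕ) (k : Fin (length (timed w τ))) →
    label (timed w τ) k ≡ lookup w (letterIndex w τ k)
  label-timed w τ k = cong proj₁ (lookup-timed w τ k)

  time-timed : (w : Word) (τ : Fin (length w) → ℕ) (k : Fin (length (timed w τ))) →
    time (timed w τ) k ≡ τ (letterIndex w τ k)
  time-timed w τ k = cong proj₂ (lookup-timed w τ k)

  endpoint-timed : ∀ h (w : Word) (τ : Fin (length w) → ℕ) → endpoint h (timed w τ) ≡ h ∙ prod w
  endpoint-timed h w τ = cong (λ v → h ∙ prod v) (labels-timed w τ)

  source-timed : ∀ h (w : Word) (τ : Fin (length w) → ℕ) (k : Fin (length (timed w τ))) →
    source h (timed w τ) k ≡ h ∙ prod (take (toℕ k) w)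
  source-timed h w τ k = cong (λ v → h ∙ prod (take (toℕ k) v)) (labels-timed w τ)

  timed-timeIncreasing : (w : Word) (τ : Fin (length w) → ℕ) →
    (∀ k → 1 ≤ τ k) → (∀ k k' → k F.< k' → τ k < τ k') → TimeIncreasing (timed w τ)
  timed-timeIncreasing w τ positive increasing =
    (λ k → subst (1 ≤_) (sym (time-timed w τ k)) (positive _)) ,
    (λ k k' k<k' → subst₂ _<_ (sym (time-timed w τ k)) (sym (time-timed w τ k'))
      (increasing _ _ (subst₂ _<_ (sym (toℕ-letterIndex w τ k)) (sym (toℕ-letterIndex w τ k')) k<k')))

module TranslatedSchedule (Γ : FiniteGroup) {d : ℕ} (Δ : Fin d → FiniteGroup.Carrier Γ)
    (w : FiniteGroup.Carrier Γ → List (Fin d)) (τ : (g : FiniteGroup.Carrier Γ) → Fin (length (w g)) → ℕ) where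
  open FiniteGroup Γ
  open Cayley Γ Δ
  open TimedWords Γ Δ
  open FiniteGroupProperties Γ

  S : Carrier → Carrier → TimedPath
  S = translatedSchedule w τ

  translated-path : (∀ g → ¬ g ≡ e → prod (w g) ≡ g) →
    (∀ g → ¬ g ≡ e → ∀ k → 1 ≤ τ g k) →
    (∀ g → ¬ g ≡ e → ∀ k k' → k F.< k' → τ g k < τ g k') →
    ∀ u v → ¬ u ≡ v → endpoint u (S u v) ≡ v × TimeIncreasing (S u v)
  translated-path spells positive increasing u v u≢v =
    (begin
      endpoint u (S u v)     ≡⟨ endpoint-timed u (w g) (τ g) ⟩
      u ∙ prod (w g)         ≡⟨ cong (u ∙_) (spells g g≢e) ⟩
      u ∙ (u \\ v)           ≡⟨ \\-leftDividesˡ u v ⟩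
      v                      ∎) ,
    timed-timeIncreasing (w g) (τ g) (positive g g≢e) (increasing g g≢e)
    where
    open ≡-Reasoning
    g = u \\ v
    g≢e = \\-≢-ε  u≢v

  translated-edges-distinct :
    (∀ g g' → ¬ g ≡ e → ¬ g' ≡ e → (k : Fin (length (w g))) (k' : Fin (length (w g'))) →
       lookup (w g) k ≡ lookup (w g') k' → τ g k ≡ τ g' k' →
       _≡_ {A = Σ Carrier (λ x → Fin (length (w x)))} (g , k) (g' , k')) →
    ∀ u v u' v' → ¬ u ≡ v → ¬ u' ≡ v' →
    (k : Fin (length (S u v))) (k' : Fin (length (S u' v'))) →
    source u (S u v) k ≡ source u' (S u' v') k' →
    label (S u v) k ≡ label (S u' v') k' →
    time (S u v) k ≡ time (S u' v') k' →
    _≡_ {A = Σ (Carrier × Carrier) (λ uv → Fin (length (S (proj₁ uv) (proj₂ uv))))}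
        ((u , v) , k) ((u' , v') , k')
  translated-edges-distinct distinct u v u' v' u≢v u'≢v' k k' same-source same-label same-time =
    Σ-Fin-≡⁺ (cong₂ _,_ u≡u' v≡v') k≡k'
    where
    open ≡-Reasoning
    g = u \\ v
    g' = u' \\ v'
    i = letterIndex (w g) (τ g) k
    i' = letterIndex (w g') (τ g') k'

    same-occurrence : (g , i) ≡ (g' , i')
    same-occurrence = distinct g g' (\\-≢-ε  u≢v) (\\-≢-ε  u'≢v') i i'
      (trans (sym (label-timed (w g) (τ g) k)) (trans same-label (label-timed (w g') (τ g') k')))
      (trans (sym (time-timed (w g) (τ g) k)) (trans same-time (time-timed (w g') (τ g') k')))

    g≡g' : g ≡ g'
    g≡g' = proj₁ (Σ-Fin-≡⁻ same-occurrence)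

    k≡k' : toℕ k ≡ toℕ k'
    k≡k' = begin
      toℕ k  ≡⟨ toℕ-letterIndex (w g) (τ g) k ⟨
      toℕ i  ≡⟨ proj₂ (Σ-Fin-≡⁻ same-occurrence) ⟩
      toℕ i' ≡⟨ toℕ-letterIndex (w g') (τ g') k' ⟩
      toℕ k' ∎

    prefix = prod (take (toℕ k) (w g))

    u≡u' : u ≡ u'
    u≡u' = ∙-cancelʳ prefix u u' (begin
      u ∙ prefix                          ≡⟨ source-timed u (w g) (τ g) k ⟨
      source u (S u v) k                  ≡⟨ same-source ⟩
      source u' (S u' v') k'              ≡⟨ source-timed u' (w g') (τ g') k' ⟩
      u' ∙ prod (take (toℕ k') (w g'))    ≡⟨ cong₂ (λ n x → u' ∙ prod (take n (w x))) k≡k' g≡g' ⟨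
      u' ∙ prefix                         ∎)

    v≡v' : v ≡ v'
    v≡v' = begin
      v              ≡⟨ \\-leftDividesˡ u v ⟨
      u ∙ g          ≡⟨ cong₂ _∙_ u≡u' g≡g' ⟩
      u' ∙ g'        ≡⟨ \\-leftDividesˡ u' v' ⟩
      v'             ∎

theorem2 : (Γ : FiniteGroup) → (d : ℕ) → (Δ : Fin d → FiniteGroup.Carrier Γ) →
    Cayley.Generates Γ Δ →
    (w : FiniteGroup.Carrier Γ → List (Fin d)) →
    (∀ g → ¬ g ≡ FiniteGroup.e Γ → Cayley.prod Γ Δ (w g) ≡ g) →
    (τ : (g : FiniteGroup.Carrier Γ) → Fin (length (w g)) → ℕ) →
    (∀ g → ¬ g ≡ FiniteGroup.e Γ → ∀ k → 1 ≤ τ g k) →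
    (∀ g → ¬ g ≡ FiniteGroup.e Γ → ∀ k k' → k F.< k' → τ g k < τ g k') →
    (∀ g g' → ¬ g ≡ FiniteGroup.e Γ → ¬ g' ≡ FiniteGroup.e Γ →
       (k : Fin (length (w g))) (k' : Fin (length (w g'))) →
       lookup (w g) k ≡ lookup (w g') k' → τ g k ≡ τ g' k' →
       _≡_ {A = Σ (FiniteGroup.Carrier Γ) (λ x → Fin (length (w x)))} (g , k) (g' , k')) →
    Cayley.IsCommGraph Γ Δ (Cayley.translatedSchedule Γ Δ w τ)
theorem2 Γ d Δ _ w spells τ positive increasing distinct =
  translated-path spells positive increasing , translated-edges-distinct distinct
  where open TranslatedSchedule Γ Δ w τ
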